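{- Let $u$ and $v$ be two vertices of a graph $G$ such that $u\cong_m v$ and the distance between $u$ and $v$ in $G$ is more than $2m$. Then Duplicator wins the $m$-round differential game on $G$ between $u$ and $v$.
   Context: Graphs are finite, simple, undirected, loopless, possibly labelled by unary predicates. For $u,v\in V(G)$, $D(u,v)=N(u)\,\Delta\,N(v)$. $u\cong_m v$ means Duplicator wins the standard $m$-round Ehrenfeucht–Fraïssé game between $(G,u)$ and $(G,v)$ (played on two copies of $G$). The $m$-round differential game on $G$ between $u$ and $v$ starts from $a_1=u$, $b_1=v$; in each round, with current tuples $(a_1,\dots,a_n)$, $(b_1,\dots,b_n)$, Spoiler chooses an index $i\le n$ and a vertex $w\in D(a_i,b_i)$ and declares whether $w$ becomes $a_{n+1}$ or $b_{n+1}$ (if all $D(a_i,b_i)$ are empty, Duplicator wins); Duplicator must reply with a vertex of $D(a_i,b_i)$ (same $i$), which becomes $b_{n+1}$, respectively $a_{n+1}$. After $m$ rounds Duplicator wins iff for all $i,j$: $a_i=a_j\iff b_i=b_j$, $a_ia_j\in E\iff b_ib_j\in E$, and $a_i,b_i$ have the same labels. -}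

module Defs where

open import Data.Nat using (ℕ; zero; suc; _≤_)
open import Data.Fin using (Fin)
open import Data.Bool using (Bool; false; true)
open import Data.Vec using (Vec; []; _∷_; lookup)
open import Data.Product using (_×_; ∃-syntax)
open import Relation.Binary.PropositionalEquality using (_≡_; _≢_)
open import Relation.Nullary using (¬_)
open import Function.Bundles using (_⇔_)

-- A finite simple loopless undirected graph on vertex set Fin n,
-- labelled by k unary predicates (label x p = true iff x satisfies predicate p).
record Graph (n k : ℕ) : Set where
  field
    adj    : Fin n → Fin n → Bool
    adj-sym : ∀ x y → adj x y ≡ adj y x
    irrefl : ∀ x → adj x x ≡ false
    label  : Fin n → Fin k → Bool

module _ {n k : ℕ} (G : Graph n k) where
  open Graph G

  data Walk : Fin n → Fin n → ℕ → Set where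
    here : ∀ {x} → Walk x x zero
    step : ∀ {x y z l} → adj x y ≡ true → Walk y z l → Walk x z (suc l)

  -- dist(x,y) > d  (including the case that x,y are in different components)
  DistGreater : Fin n → Fin n → ℕ → Set
  DistGreater x y d = ∀ l → l ≤ d → ¬ Walk x y l

  -- w ∈ D(x,y) = N(x) Δ N(y)
  InD : Fin n → Fin n → Fin n → Set
  InD x y w = adj x w ≢ adj y w

  PartialIso : ∀ {l} → Vec (Fin n) l → Vec (Fin n) l → Set
  PartialIso as bs =
    (∀ i j → (lookup as i ≡ lookup as j) ⇔ (lookup bs i ≡ lookup bs j))
    × (∀ i j → adj (lookup as i) (lookup as j) ≡ adj (lookup bs i) (lookup bs j))
    × (∀ i p → label (lookup as i) p ≡ label (lookup bs i) p)

  -- New pebbles are prepended; the win condition is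
  -- symmetric in positions, so the order is irrelevant.
  EFWin : ℕ → ∀ {l} → Vec (Fin n) l → Vec (Fin n) l → Set
  EFWin zero    as bs = PartialIso as bs
  EFWin (suc m) as bs =
    (∀ x → ∃[ y ] EFWin m (x ∷ as) (y ∷ bs))
    × (∀ y → ∃[ x ] EFWin m (x ∷ as) (y ∷ bs))

  EFEquiv : ℕ → Fin n → Fin n → Set
  EFEquiv m u v = EFWin m (u ∷ []) (v ∷ [])

  -- If all D(a_i,b_i) are empty Spoiler has no move, and the universally
  -- quantified clause holds vacuously, i.e. Duplicator wins.
  DiffWin : ℕ → ∀ {l} → Vec (Fin n) l → Vec (Fin n) l → Set
  DiffWin zero    as bs = PartialIso as bs
  DiffWin (suc m) as bs =
    ∀ i w → InD (lookup as i) (lookup bs i) w →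
      (∃[ w' ] (InD (lookup as i) (lookup bs i) w' × DiffWin m (w ∷ as) (w' ∷ bs)))
      × (∃[ w' ] (InD (lookup as i) (lookup bs i) w' × DiffWin m (w' ∷ as) (w ∷ bs)))

  DiffGameWin : ℕ → Fin n → Fin n → Set
  DiffGameWin m u v = DiffWin m (u ∷ []) (v ∷ [])

module Submission where

-- Duplicator keeps a "canonical" EF position (xs, ys): the pebbles xs
-- lie within distance d of u, the pebbles ys within distance d of v, after d
-- rounds, and she still wins the remaining EF game on (xs, ys).  The actual
-- differential position (as, bs) is the canonical one with some pebble pairs
-- swapped.  A Spoiler move w ∈ D(xᵢ, yᵢ) is adjacent to exactly one of xᵢ, yᵢ,
-- say xᵢ; Duplicator answers by the EF reply y' to w, which is adjacent to yᵢ
-- and, by the distance bound, not to xᵢ, so y' ∈ D(xᵢ, yᵢ) and (w, y') extends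
-- the canonical position.  Because the two sides stay far apart, no pebble of
-- xs equals a pebble of ys and cross-adjacencies are symmetric; hence at the
-- end every swapped version of the canonical partial isomorphism is again a
-- partial isomorphism.

open import Defs
open import Data.Bool using (true; false)
open import Data.Bool.Properties using (¬-not)
open import Data.Empty using (⊥; ⊥-elim)
open import Data.Fin using (Fin; zero; suc)
open import Data.Nat using (ℕ; zero; suc; _+_; _*_; _≤_; z≤n; s≤s)
open import Data.Nat.Properties
  using (≤-refl; ≤-trans; ≤-reflexive; m≤m+n; m≤n⇒m≤1+n; +-suc; +-identityʳ; +-mono-≤; +-monoʳ-≤; +-monoˡ-≤)
open import Data.Product using (_×_; _,_; proj₁; proj₂; ∃-syntax; swap)
open import Data.Sum using (_⊎_; inj₁; inj₂) renaming (swap to ⊎-swap)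
open import Data.Vec using (Vec; []; _∷_; lookup)
open import Function.Bundles using (_⇔_; mk⇔)
open import Function.Construct.Symmetry using (⇔-sym)
open import Relation.Binary.PropositionalEquality
  using (_≡_; _≢_; refl; sym; trans; cong; subst; subst₂)

module Basics {n k : ℕ} (G : Graph n k) where
  open Graph G

  _++ʷ_ : ∀ {x y z l₁ l₂} → Walk G x y l₁ → Walk G y z l₂ → Walk G x z (l₁ + l₂)
  here     ++ʷ q = q
  step e p ++ʷ q = step e (p ++ʷ q)

  _▷_ : ∀ {x y z l} → Walk G x y l → adj y z ≡ true → Walk G x z (suc l)
  here     ▷ e = step e here
  step e p ▷ f = step e (p ▷ f)

  reverse : ∀ {x y l} → Walk G x y l → Walk G y x l
  reverse here               = here
  reverse (step {x} {y} e p) = reverse p ▷ trans (adj-sym y x) e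

  Near : Fin n → Fin n → ℕ → Set
  Near c z d = ∃[ l ] (l ≤ d × Walk G c z l)

  near-refl : ∀ {c} → Near c c 0
  near-refl = 0 , z≤n , here

  near-step : ∀ {c z w d} → Near c z d → adj z w ≡ true → Near c w (suc d)
  near-step (l , l≤d , p) e = suc l , s≤s l≤d , p ▷ e

  near-weaken : ∀ {c z d} → Near c z d → Near c z (suc d)
  near-weaken (l , l≤d , p) = l , m≤n⇒m≤1+n l≤d , p

  apart : ∀ {u v D z₁ z₂ d₁ d₂ e} → DistGreater G u v D →
          Near u z₁ d₁ → Near v z₂ d₂ → Walk G z₁ z₂ e → d₁ + (e + d₂) ≤ D → ⊥
  apart far (l₁ , l₁≤d₁ , p₁) (l₂ , l₂≤d₂ , p₂) q bound =
    far _ (≤-trans (+-mono-≤ l₁≤d₁ (+-monoʳ-≤ _ l₂≤d₂)) bound) (p₁ ++ʷ (q ++ʷ reverse p₂))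

  partialIso-tail : ∀ {l x y} {xs ys : Vec (Fin n) l} →
                    PartialIso G (x ∷ xs) (y ∷ ys) → PartialIso G xs ys
  partialIso-tail (eqs , adjs , labels) =
    (λ i j → eqs (suc i) (suc j)) , (λ i j → adjs (suc i) (suc j)) , (λ i p → labels (suc i) p)

  partialIso-sym : ∀ {l} {xs ys : Vec (Fin n) l} → PartialIso G xs ys → PartialIso G ys xs
  partialIso-sym (eqs , adjs , labels) =
    (λ i j → ⇔-sym (eqs i j)) , (λ i j → sym (adjs i j)) , (λ i p → sym (labels i p))

  -- Winning EF positions are partial isomorphisms (a vertex z serves as a
  -- dummy Spoiler move through the remaining rounds), and the game is symmetric.
  efWin⇒partialIso : ∀ j {l} {xs ys : Vec (Fin n) l} → Fin n → EFWin G j xs ys → PartialIso G xs ys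
  efWin⇒partialIso zero    z win         = win
  efWin⇒partialIso (suc j) z (forth , _) = partialIso-tail (efWin⇒partialIso j z (proj₂ (forth z)))

  efWin-sym : ∀ j {l} {xs ys : Vec (Fin n) l} → EFWin G j xs ys → EFWin G j ys xs
  efWin-sym zero {xs = xs} {ys} win = partialIso-sym {xs = xs} {ys} win
  efWin-sym (suc j) (forth , back)  =
    (λ y → proj₁ (back y) , efWin-sym j (proj₂ (back y))) ,
    (λ x → proj₁ (forth x) , efWin-sym j (proj₂ (forth x)))

  efReply : ∀ {j l} {xs ys : Vec (Fin n) l} → EFWin G (suc j) xs ys → ∀ x →
            ∃[ y ] (EFWin G j (x ∷ xs) (y ∷ ys) × (∀ i → adj (lookup xs i) x ≡ adj (lookup ys i) y))
  efReply {j} {xs = xs} {ys} (forth , _) x = y , win , λ i → proj₁ (proj₂ (efWin⇒partialIso j x win)) (suc i) zero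
    where
    y : Fin n
    y = proj₁ (forth x)
    win : EFWin G j (x ∷ xs) (y ∷ ys)
    win = proj₂ (forth x)

  Compatible : Fin n × Fin n → Fin n × Fin n → Set
  Compatible (a , b) (a' , b') = (a ≡ a' ⇔ b ≡ b') × adj a a' ≡ adj b b'

  compatible-swap : ∀ {p q} → Compatible p q → Compatible (swap p) (swap q)
  compatible-swap (eq , ad) = ⇔-sym eq , sym ad

  Oriented : Fin n × Fin n → Fin n → Fin n → Set
  Oriented p x y = p ≡ (x , y) ⊎ p ≡ (y , x)

  Ori : ∀ {l} → (xs ys as bs : Vec (Fin n) l) → Set
  Ori xs ys as bs = ∀ i → Oriented (lookup as i , lookup bs i) (lookup xs i) (lookup ys i)

  _∷ᵒ_ : ∀ {l a b x y} {xs ys as bs : Vec (Fin n) l} →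
         Oriented (a , b) x y → Ori xs ys as bs → Ori (x ∷ xs) (y ∷ ys) (a ∷ as) (b ∷ bs)
  (o ∷ᵒ ori) zero    = o
  (o ∷ᵒ ori) (suc i) = ori i

  ori-swap : ∀ {l} {xs ys as bs : Vec (Fin n) l} → Ori xs ys as bs → Ori ys xs as bs
  ori-swap ori i = ⊎-swap (ori i)

  reorient-partialIso :
    ∀ {l} {xs ys as bs : Vec (Fin n) l} → PartialIso G xs ys →
    (∀ i j → lookup xs i ≢ lookup ys j) →
    (∀ i j → adj (lookup xs i) (lookup ys j) ≡ adj (lookup xs j) (lookup ys i)) →
    Ori xs ys as bs → PartialIso G as bs
  reorient-partialIso {xs = xs} {ys} {as} {bs} (eqs , adjs , labels) disjoint crossAdj ori =
    (λ i j → proj₁ (compatible i j)) , (λ i j → proj₂ (compatible i j)) , sameLabels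
    where
    straight : ∀ i j → Compatible (lookup xs i , lookup ys i) (lookup xs j , lookup ys j)
    straight i j = eqs i j , adjs i j

    crossed : ∀ i j → Compatible (lookup xs i , lookup ys i) (lookup ys j , lookup xs j)
    crossed i j = mk⇔ (λ e → ⊥-elim (disjoint i j e)) (λ e → ⊥-elim (disjoint j i (sym e))) ,
                  trans (crossAdj i j) (adj-sym (lookup xs j) (lookup ys i))

    compatible : ∀ i j → Compatible (lookup as i , lookup bs i) (lookup as j , lookup bs j)
    compatible i j with ori i | ori j
    ... | inj₁ eᵢ | inj₁ eⱼ = subst₂ Compatible (sym eᵢ) (sym eⱼ) (straight i j)
    ... | inj₁ eᵢ | inj₂ eⱼ = subst₂ Compatible (sym eᵢ) (sym eⱼ) (crossed i j)
    ... | inj₂ eᵢ | inj₁ eⱼ = subst₂ Compatible (sym eᵢ) (sym eⱼ) (compatible-swap (crossed i j))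
    ... | inj₂ eᵢ | inj₂ eⱼ = subst₂ Compatible (sym eᵢ) (sym eⱼ) (compatible-swap (straight i j))

    sameLabels : ∀ i p → label (lookup as i) p ≡ label (lookup bs i) p
    sameLabels i p with ori i
    ... | inj₁ e = subst (λ q → label (proj₁ q) p ≡ label (proj₂ q) p) (sym e) (labels i p)
    ... | inj₂ e = subst (λ q → label (proj₁ q) p ≡ label (proj₂ q) p) (sym e) (sym (labels i p))

module Game {n k : ℕ} (G : Graph n k) (m : ℕ) where
  open Graph G
  open Basics G

  record Canonical (u v : Fin n) (d j : ℕ) {l : ℕ} (xs ys : Vec (Fin n) l) : Set where
    field
      near-u   : ∀ i → Near u (lookup xs i) d
      near-v   : ∀ i → Near v (lookup ys i) d
      far      : DistGreater G u v (2 * m)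
      budget   : d + j ≤ m
      disjoint : ∀ i i' → lookup xs i ≢ lookup ys i'
      crossAdj : ∀ i i' → adj (lookup xs i) (lookup ys i') ≡ adj (lookup xs i') (lookup ys i)
      efWin    : EFWin G j xs ys
  open Canonical

  canonical-swap : ∀ {u v d j l} {xs ys : Vec (Fin n) l} → Canonical u v d j xs ys → Canonical v u d j ys xs
  canonical-swap {xs = xs} {ys} c = record
    { near-u   = near-v c
    ; near-v   = near-u c
    ; far      = λ l l≤2m p → far c l l≤2m (reverse p)
    ; budget   = budget c
    ; disjoint = λ i i' e → disjoint c i' i (sym e)
    ; crossAdj = λ i i' → trans (adj-sym (lookup ys i) (lookup xs i'))
                            (trans (crossAdj c i' i) (adj-sym (lookup xs i) (lookup ys i')))
    ; efWin    = efWin-sym _ (efWin c) }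

  noShortWalk : ∀ {u v d j l a b e} {xs ys : Vec (Fin n) l} → Canonical u v d (suc j) xs ys →
                Near u a d → Near v b d → Walk G a b e → e ≤ 2 → ⊥
  noShortWalk {d = d} {j} c na nb p e≤2 =
    apart (far c) na nb p (≤-trans (+-monoʳ-≤ d (+-monoˡ-≤ d e≤2)) roundBound)
    where
    roundBound : d + (2 + d) ≤ 2 * m
    roundBound = ≤-trans (≤-reflexive (+-suc d (suc d)))
                  (≤-trans (+-mono-≤ oneMore oneMore) (≤-reflexive (cong (m +_) (sym (+-identityʳ m)))))
      where
      oneMore : suc d ≤ m
      oneMore = ≤-trans (s≤s (m≤m+n d j)) (≤-trans (≤-reflexive (sym (+-suc d j))) (budget c))

  extend : ∀ {u v d j l} {xs ys : Vec (Fin n) l} → Canonical u v d (suc j) xs ys →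
           ∀ i w → adj (lookup xs i) w ≡ true →
           ∃[ y' ] (InD G (lookup xs i) (lookup ys i) y' × Canonical u v (suc d) j (w ∷ xs) (y' ∷ ys))
  extend {u} {v} {d} {j} {xs = xs} {ys} c i w xᵢw = y' , inD , c'
    where
    x y y' : Fin n
    x = lookup xs i
    y = lookup ys i
    y' = proj₁ (efReply (efWin c) w)

    y'-win : EFWin G j (w ∷ xs) (y' ∷ ys)
    y'-win = proj₁ (proj₂ (efReply (efWin c) w))

    y'-adj : ∀ a → adj (lookup xs a) w ≡ adj (lookup ys a) y'
    y'-adj = proj₂ (proj₂ (efReply (efWin c) w))

    yy' : adj y y' ≡ true
    yy' = trans (sym (y'-adj i)) xᵢw
    y'y : adj y' y ≡ true
    y'y = trans (adj-sym y' y) yy'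
    toY : ∀ {z} → y' ≡ z → adj z y ≡ true
    toY y'≡z = subst (λ z → adj z y ≡ true) y'≡z y'y

    -- Each of these adjacencies would give a walk of length ≤ 2 from near u to near v.
    xy' : adj x y' ≡ false
    xy' = ¬-not (λ e → noShortWalk c (near-u c i) (near-v c i) (step e (step y'y here)) ≤-refl)
    wys : ∀ b → adj w (lookup ys b) ≡ false
    wys b = ¬-not (λ e → noShortWalk c (near-u c i) (near-v c b) (step xᵢw (step e here)) ≤-refl)
    xsy' : ∀ a → adj (lookup xs a) y' ≡ false
    xsy' a = ¬-not (λ e → noShortWalk c (near-u c a) (near-v c i) (step e (step y'y here)) ≤-refl)

    inD : InD G x y y'
    inD e with trans (sym xy') (trans e yy')
    ... | ()

    near-u' : ∀ a → Near u (lookup (w ∷ xs) a) (suc d)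
    near-u' zero    = near-step (near-u c i) xᵢw
    near-u' (suc a) = near-weaken (near-u c a)

    near-v' : ∀ b → Near v (lookup (y' ∷ ys) b) (suc d)
    near-v' zero    = near-step (near-v c i) yy'
    near-v' (suc b) = near-weaken (near-v c b)

    disjoint' : ∀ a b → lookup (w ∷ xs) a ≢ lookup (y' ∷ ys) b
    disjoint' zero zero w≡y' =
      noShortWalk c (near-u c i) (near-v c i) (step xᵢw (step (toY (sym w≡y')) here)) ≤-refl
    disjoint' zero (suc b) w≡yb =
      noShortWalk c (near-u c i) (near-v c b) (step (subst (λ z → adj x z ≡ true) w≡yb xᵢw) here) (s≤s z≤n)
    disjoint' (suc a) zero xa≡y' =
      noShortWalk c (near-u c a) (near-v c i) (step (toY (sym xa≡y')) here) (s≤s z≤n)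
    disjoint' (suc a) (suc b) = disjoint c a b

    crossAdj' : ∀ a b → adj (lookup (w ∷ xs) a) (lookup (y' ∷ ys) b) ≡ adj (lookup (w ∷ xs) b) (lookup (y' ∷ ys) a)
    crossAdj' zero    zero    = refl
    crossAdj' zero    (suc b) = trans (wys b) (sym (xsy' b))
    crossAdj' (suc a) zero    = trans (xsy' a) (sym (wys a))
    crossAdj' (suc a) (suc b) = crossAdj c a b

    c' : Canonical u v (suc d) j (w ∷ xs) (y' ∷ ys)
    c' = record
      { near-u = near-u' ; near-v = near-v' ; far = far c
      ; budget = subst (_≤ m) (+-suc d j) (budget c)
      ; disjoint = disjoint' ; crossAdj = crossAdj' ; efWin = y'-win }

  -- Every w ∈ D(xᵢ, yᵢ) is adjacent to xᵢ or to yᵢ; in the second case apply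
  -- extend with the roles of u and v exchanged.
  canonicalReply : ∀ {u v d j l} {xs ys : Vec (Fin n) l} → Canonical u v d (suc j) xs ys →
                   ∀ i w → InD G (lookup xs i) (lookup ys i) w →
                   ∃[ w' ] (InD G (lookup xs i) (lookup ys i) w' ×
                            (Canonical u v (suc d) j (w ∷ xs) (w' ∷ ys) ⊎ Canonical u v (suc d) j (w' ∷ xs) (w ∷ ys)))
  canonicalReply {xs = xs} c i w inD with adj (lookup xs i) w in xᵢw
  ... | true  with extend c i w xᵢw
  ...   | y' , inD' , c' = y' , inD' , inj₁ c'
  canonicalReply {xs = xs} c i w inD | false
    with extend (canonical-swap c) i w (¬-not (λ e → inD (sym e)))
  ...   | x' , inD' , c' = x' , (λ e → inD' (sym e)) , inj₂ (canonical-swap c')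

  Replies : ℕ → ∀ {l} → Vec (Fin n) l → Vec (Fin n) l → Fin n → Fin n → Fin n → Set
  Replies j as bs a b w =
    (∃[ w' ] (InD G a b w' × DiffWin G j (w ∷ as) (w' ∷ bs))) ×
    (∃[ w' ] (InD G a b w' × DiffWin G j (w' ∷ as) (w ∷ bs)))

  WinsFromCanonical : ℕ → Set
  WinsFromCanonical j = ∀ {u v d l} {xs ys as bs : Vec (Fin n) l} →
                        Canonical u v d j xs ys → Ori xs ys as bs → DiffWin G j as bs

  reply : ∀ {j} → WinsFromCanonical j →
          ∀ {u v d l} {xs ys as bs : Vec (Fin n) l} → Canonical u v d (suc j) xs ys → Ori xs ys as bs →
          ∀ i w {a b} → (a , b) ≡ (lookup xs i , lookup ys i) → InD G a b w → Replies j as bs a b w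
  reply wins c ori i w refl inD with canonicalReply c i w inD
  ... | w' , inD' , inj₁ c' = (w' , inD' , wins c' (inj₁ refl ∷ᵒ ori)) , (w' , inD' , wins c' (inj₂ refl ∷ᵒ ori))
  ... | w' , inD' , inj₂ c' = (w' , inD' , wins c' (inj₂ refl ∷ᵒ ori)) , (w' , inD' , wins c' (inj₁ refl ∷ᵒ ori))

  -- Induction on the number of remaining rounds; a swapped pebble pair is
  -- handled by exchanging the roles of u and v.
  winsFromCanonical : ∀ j → WinsFromCanonical j
  winsFromCanonical zero {xs = xs} {ys} {as} {bs} c ori =
    reorient-partialIso {xs = xs} {ys} {as} {bs} (efWin c) (disjoint c) (crossAdj c) ori
  winsFromCanonical (suc j) {xs = xs} {ys} {as} {bs} c ori i w inD with ori i
  ... | inj₁ e = reply (winsFromCanonical j) c ori i w e inD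
  ... | inj₂ e = reply (winsFromCanonical j) (canonical-swap c) (ori-swap {xs = xs} {ys} {as} {bs} ori) i w e inD

-- The initial pair (u, v) is canonical with d = 0 and j = m; its sides are
-- disjoint because dist(u,v) > 0, and it is trivially in canonical orientation.
lemma6p2 : ∀ {n k} (G : Graph n k) (m : ℕ) (u v : Fin n) →
    EFEquiv G m u v → DistGreater G u v (2 * m) → DiffGameWin G m u v
lemma6p2 G m u v uv far = Game.winsFromCanonical G m m start (λ { zero → inj₁ refl })
  where
  open Basics G
  start : Game.Canonical G m u v 0 m (u ∷ []) (v ∷ [])
  start = record
    { near-u   = λ { zero → near-refl }
    ; near-v   = λ { zero → near-refl }
    ; far      = far
    ; budget   = ≤-refl
    ; disjoint = λ { zero zero u≡v → far 0 z≤n (subst (λ z → Walk G u z 0) u≡v here) }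
    ; crossAdj = λ { zero zero → refl }
    ; efWin    = uv }
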